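{- Fix an integer $s\ge 4$. For integers $m\ge 0$ and $i$, let $\gamma^{(s)}_{m,i}$ be the number of standard Young tableaux with $m$ cells and at most $s$ columns such that the length of the second column minus the length of the third column equals $i$. For $1\le j\le s-1$, let $r^{(s)}_j(m,i)$ be the number of such tableaux (with $m$ cells, at most $s$ columns, second-minus-third column difference $i$) whose $j$-th and $(j+1)$-th columns have the same length (with $r^{(s)}_j(m,i)=0$ if $i<0$). Then for every $n\ge s$, $$\gamma^{(s)}_{n,0}=(s-2)\gamma^{(s)}_{n-1,0}+\gamma^{(s)}_{n-1,1}-\sum_{j=3}^{s-1}r^{(s)}_j(n-1,0),$$ and for every $1\le i\le \lfloor n/2\rfloor$, $$\gamma^{(s)}_{n,i}=\gamma^{(s)}_{n-1,i-1}+(s-2)\gamma^{(s)}_{n-1,i}+\gamma^{(s)}_{n-1,i+1}-r^{(s)}_1(n-1,i-1)-\sum_{j=3}^{s-1}r^{(s)}_j(n-1,i).$$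
   Context: The shape of a standard Young tableau with at most $s$ columns is written as a list of $s$ column lengths $(c_1,\dots,c_s)$ with $c_1\ge c_2\ge\cdots\ge c_s\ge 0$, zero entries standing for absent columns; in particular two absent columns count as columns of the same length $0$. -}

module Defs where

open import Data.Bool using (Bool; true; false; _∧_)
open import Data.Nat using (ℕ; zero; suc; _≤ᵇ_; _≡ᵇ_; _∸_; _+_)
open import Data.Integer using (ℤ; +_; _-_)
import Data.Integer as ℤ
open import Data.Fin using (Fin; toℕ)
open import Data.List using (List; []; _∷_; map; concatMap; length; filterᵇ; replicate; foldr; upTo; allFin)
open import Relation.Nullary.Decidable using (⌊_⌋)

-- A shape with at most s columns is the list of its s column lengths
-- (c_1, ..., c_s), zero entries standing for absent columns.

col : List ℕ → ℕ → ℕ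
col []       _       = 0
col (x ∷ xs) zero    = x
col (x ∷ xs) (suc k) = col xs k

inc : List ℕ → ℕ → List ℕ
inc []       _       = []
inc (x ∷ xs) zero    = suc x ∷ xs
inc (x ∷ xs) (suc k) = x ∷ inc xs k

nonincr : List ℕ → Bool
nonincr []             = true
nonincr (x ∷ [])       = true
nonincr (x ∷ y ∷ xs)   = (y ≤ᵇ x) ∧ nonincr (y ∷ xs)

-- A standard Young tableau with m cells and at most s columns is encoded,
-- as usual, by the saturated chain of Young diagrams
--   ∅ = λ⁰ ⊂ λ¹ ⊂ ... ⊂ λᵐ  (λᵏ = cells with entries ≤ k),
-- i.e. by the word w ∈ (Fin s)^m recording the column into which entry k
-- is placed; the word is valid iff every intermediate shape is a Young diagram.

validFrom : List ℕ → ∀ {s} → List (Fin s) → Bool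
validFrom c []      = true
validFrom c (j ∷ w) = nonincr (inc c (toℕ j)) ∧ validFrom (inc c (toℕ j)) w

shapeFrom : List ℕ → ∀ {s} → List (Fin s) → List ℕ
shapeFrom c []      = c
shapeFrom c (j ∷ w) = shapeFrom (inc c (toℕ j)) w

emptyShape : ℕ → List ℕ
emptyShape s = replicate s 0


words : (s m : ℕ) → List (List (Fin s))
words s zero    = [] ∷ []
words s (suc m) = concatMap (λ j → map (j ∷_) (words s m)) (allFin s)

SYTs : (s m : ℕ) → List (List (Fin s))
SYTs s m = filterᵇ (validFrom (emptyShape s)) (words s m)

shape : (s : ℕ) → List (Fin s) → List ℕ
shape s w = shapeFrom (emptyShape s) w

diff23 : List ℕ → ℤ
diff23 c = (+ col c 1) - (+ col c 2)

γ : (s m : ℕ) → ℤ → ℤ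
γ s m i = + length (filterᵇ (λ w → ⌊ diff23 (shape s w) ℤ.≟ i ⌋) (SYTs s m))

-- r^{(s)}_j(m,i) : additionally columns j and j+1 (1-based) have equal length
r : (s j m : ℕ) → ℤ → ℤ
r s j m i = + length (filterᵇ
  (λ w → ⌊ diff23 (shape s w) ℤ.≟ i ⌋ ∧ (col (shape s w) (j ∸ 1) ≡ᵇ col (shape s w) j))
  (SYTs s m))

sum3to : ℕ → (ℕ → ℤ) → ℤ
sum3to s f = foldr ℤ._+_ (+ 0) (map (λ k → f (3 + k)) (upTo (s ∸ 3)))

module Submission where

-- For a
-- weight f on shapes, `paths s m f c` sums f over the endpoints of all
-- m-step growth paths from c, so γ and r are such sums for indicator
-- weights (count-paths).  One growth step is the linear operator `grow`,
-- and removing the last cell gives paths (m+1) f = paths m (grow f).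
-- The recurrence is then the image under the linear map `paths m` of an
-- identity at a single Young diagram d (local-recurrence): adding a cell to
-- column 1 or to a column j ≥ 4 keeps the statistic diff23, column 2 raises
-- it by one, column 3 lowers it by one, and an addition to column j+1 is
-- forbidden exactly when columns j and j+1 are tied -- the shapes counted
-- by the correction terms r_j.

open import Defs
open import Data.Nat using (ℕ; _≤_; _∸_; _/_)
open import Data.Integer using (ℤ; +_; _+_; _-_; _*_)
open import Data.Product using (_×_)
open import Relation.Binary.PropositionalEquality using (_≡_)

open import Data.Nat as ℕ using (zero; suc; _≤ᵇ_; _≡ᵇ_; _<_; z≤n; s≤s)
import Data.Nat.Properties as ℕP
import Data.Integer as ℤ
import Data.Integer.Properties as ℤP
open import Data.Bool using (Bool; true; false; _∧_; not)
open import Data.Bool.Properties using (T-≡; ∧-conicalˡ; ∧-conicalʳ; ∧-identityʳ)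
open import Data.List using (List; []; _∷_; length; filterᵇ; concatMap; map; _++_; foldr; applyUpTo; tabulate; allFin)
open import Data.List.Properties using (length-++; filter-++)
open import Data.Fin using (Fin; toℕ) renaming (zero to fzero; suc to fsuc)
open import Data.Product using (Σ; _,_)
open import Function using (_∘_; Equivalence)
open import Relation.Binary.PropositionalEquality using (refl; sym; trans; cong; cong₂; subst; module ≡-Reasoning)
open import Relation.Nullary using (contradiction)
open import Relation.Nullary.Decidable using (⌊_⌋; yes; no; T?)
open import Data.Nat.Tactic.RingSolver using () renaming (solve-∀ to ℕ-solve)
open import Data.Integer.Tactic.RingSolver using () renaming (solve-∀ to ℤ-solve)

ind : Bool → ℕ
ind true  = 1
ind false = 0

ind-true : ∀ {b} x → b ≡ true → ind b ℕ.* x ≡ x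
ind-true x refl = ℕP.+-identityʳ x

split-on : ∀ p q → ind (not q) ℕ.* ind p ℕ.+ ind (p ∧ q) ≡ ind p
split-on true  true  = refl
split-on true  false = refl
split-on false true  = refl
split-on false false = refl

guard-redundant : ∀ p q → (q ≡ true → p ≡ false) → ind (not q) ℕ.* ind p ≡ ind p
guard-redundant p     false _ = ℕP.+-identityʳ (ind p)
guard-redundant false true  _ = refl
guard-redundant true  true  excl with () ← excl refl

≤ᵇ-true⇒≤ : ∀ m n → (m ≤ᵇ n) ≡ true → m ≤ n
≤ᵇ-true⇒≤ m n h = ℕP.≤ᵇ⇒≤ m n (Equivalence.from T-≡ h)

≤⇒≤ᵇ-true : ∀ {m n} → m ≤ n → (m ≤ᵇ n) ≡ true
≤⇒≤ᵇ-true p = Equivalence.to T-≡ (ℕP.≤⇒≤ᵇ p)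

≡ᵇ-true⇒≡ : ∀ m n → (m ≡ᵇ n) ≡ true → m ≡ n
≡ᵇ-true⇒≡ m n h = ℕP.≡ᵇ⇒≡ m n (Equivalence.from T-≡ h)

<ᵇ-as-≢ : ∀ x y → y ≤ x → (suc y ≤ᵇ x) ≡ not (x ≡ᵇ y)
<ᵇ-as-≢ zero    zero    z≤n     = refl
<ᵇ-as-≢ (suc x) zero    z≤n     = refl
<ᵇ-as-≢ (suc x) (suc y) (s≤s p) = <ᵇ-as-≢ x y p

nonincr-inc₀ : ∀ x xs → nonincr (x ∷ xs) ≡ true → nonincr (suc x ∷ xs) ≡ true
nonincr-inc₀ x []       _ = refl
nonincr-inc₀ x (y ∷ xs) h =
  trans (cong (_∧ nonincr (y ∷ xs)) (≤⇒≤ᵇ-true (ℕP.m≤n⇒m≤1+n y≤x))) (∧-conicalʳ _ _ h)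
  where
  y≤x : y ≤ x
  y≤x = ≤ᵇ-true⇒≤ y x (∧-conicalˡ _ _ h)

nonincr-inc : ∀ d k → nonincr d ≡ true → suc k < length d →
              nonincr (inc d (suc k)) ≡ not (col d k ≡ᵇ col d (suc k))
nonincr-inc (x ∷ []) zero h (s≤s ())
nonincr-inc (x ∷ y ∷ xs) zero h _ =
  trans (cong ((suc y ≤ᵇ x) ∧_) (nonincr-inc₀ y xs (∧-conicalʳ _ _ h)))
    (trans (∧-identityʳ (suc y ≤ᵇ x)) (<ᵇ-as-≢ x y (≤ᵇ-true⇒≤ y x (∧-conicalˡ _ _ h))))
nonincr-inc (x ∷ y ∷ xs) (suc k) h (s≤s bound) =
  trans (cong (_∧ nonincr (inc (y ∷ xs) (suc k))) (∧-conicalˡ _ _ h))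
        (nonincr-inc (y ∷ xs) k (∧-conicalʳ _ _ h) bound)

length-inc : ∀ d j → length (inc d j) ≡ length d
length-inc []      j       = refl
length-inc (x ∷ d) zero    = refl
length-inc (x ∷ d) (suc j) = cong suc (length-inc d j)

nonincr-empty : ∀ s → nonincr (emptyShape s) ≡ true
nonincr-empty zero          = refl
nonincr-empty (suc zero)    = refl
nonincr-empty (suc (suc s)) = nonincr-empty (suc s)

length-empty : ∀ s → length (emptyShape s) ≡ s
length-empty zero    = refl
length-empty (suc s) = cong suc (length-empty s)

sumN : ℕ → (ℕ → ℕ) → ℕ
sumN zero    f = 0
sumN (suc n) f = f 0 ℕ.+ sumN n (f ∘ suc)

sumN-cong< : ∀ n {f g} → (∀ k → k < n → f k ≡ g k) → sumN n f ≡ sumN n g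
sumN-cong< zero    eq = refl
sumN-cong< (suc n) eq = cong₂ ℕ._+_ (eq 0 (s≤s z≤n)) (sumN-cong< n (λ k lt → eq (suc k) (s≤s lt)))

sumN-cong : ∀ n {f g} → (∀ k → f k ≡ g k) → sumN n f ≡ sumN n g
sumN-cong n eq = sumN-cong< n (λ k _ → eq k)

sumN-+ : ∀ n f g → sumN n (λ k → f k ℕ.+ g k) ≡ sumN n f ℕ.+ sumN n g
sumN-+ zero    f g = refl
sumN-+ (suc n) f g =
  trans (cong (f 0 ℕ.+ g 0 ℕ.+_) (sumN-+ n (f ∘ suc) (g ∘ suc))) (interchange (f 0) (g 0) _ _)
  where
  interchange : ∀ a b c d → a ℕ.+ b ℕ.+ (c ℕ.+ d) ≡ a ℕ.+ c ℕ.+ (b ℕ.+ d)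
  interchange = ℕ-solve

sumN-* : ∀ n k f → sumN n (λ j → k ℕ.* f j) ≡ k ℕ.* sumN n f
sumN-* zero    k f = sym (ℕP.*-zeroʳ k)
sumN-* (suc n) k f =
  trans (cong (k ℕ.* f 0 ℕ.+_) (sumN-* n k (f ∘ suc))) (sym (ℕP.*-distribˡ-+ k _ _))

sumN-const : ∀ n c → sumN n (λ _ → c) ≡ n ℕ.* c
sumN-const zero    c = refl
sumN-const (suc n) c = cong (c ℕ.+_) (sumN-const n c)

sumList : {A : Set} → List A → (A → ℕ) → ℕ
sumList []       f = 0
sumList (x ∷ xs) f = f x ℕ.+ sumList xs f

sumList-tabulate : ∀ {A : Set} n (g : Fin n → A) (F : A → ℕ) (f : ℕ → ℕ) →
                   (∀ j → F (g j) ≡ f (toℕ j)) → sumList (tabulate g) F ≡ sumN n f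
sumList-tabulate zero    g F f eq = refl
sumList-tabulate (suc n) g F f eq =
  cong₂ ℕ._+_ (eq fzero) (sumList-tabulate n (g ∘ fsuc) F (f ∘ suc) (eq ∘ fsuc))

length-filter-++ : ∀ {A : Set} (p : A → Bool) xs ys →
  length (filterᵇ p (xs ++ ys)) ≡ length (filterᵇ p xs) ℕ.+ length (filterᵇ p ys)
length-filter-++ p xs ys = trans (cong length (filter-++ (T? ∘ p) xs ys)) (length-++ (filterᵇ p xs))

length-filter-concatMap : ∀ {A B : Set} (p : B → Bool) (F : A → List B) xs →
  length (filterᵇ p (concatMap F xs)) ≡ sumList xs (λ x → length (filterᵇ p (F x)))
length-filter-concatMap p F []       = refl
length-filter-concatMap p F (x ∷ xs) =
  trans (length-filter-++ p (F x) (concatMap F xs)) (cong (_ ℕ.+_) (length-filter-concatMap p F xs))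

length-filter-map : ∀ {A B : Set} (p : B → Bool) (g : A → B) xs →
  length (filterᵇ p (map g xs)) ≡ length (filterᵇ (p ∘ g) xs)
length-filter-map p g []       = refl
length-filter-map p g (x ∷ xs) with p (g x)
... | true  = cong suc (length-filter-map p g xs)
... | false = length-filter-map p g xs

length-filter-filter : ∀ {A : Set} (p q : A → Bool) xs →
  length (filterᵇ p (filterᵇ q xs)) ≡ length (filterᵇ (λ x → q x ∧ p x) xs)
length-filter-filter p q []       = refl
length-filter-filter p q (x ∷ xs) with q x
... | false = length-filter-filter p q xs
... | true with p x
...   | true  = cong suc (length-filter-filter p q xs)
...   | false = length-filter-filter p q xs

length-filter-guard : ∀ {A : Set} b (q r : A → Bool) xs →
  length (filterᵇ (λ x → (b ∧ q x) ∧ r x) xs) ≡ ind b ℕ.* length (filterᵇ (λ x → q x ∧ r x) xs)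
length-filter-guard true  q r xs = sym (ℕP.+-identityʳ _)
length-filter-guard false q r xs = nothing-passes xs
  where
  nothing-passes : ∀ ys → length (filterᵇ (λ _ → false) ys) ≡ 0
  nothing-passes []       = refl
  nothing-passes (_ ∷ ys) = nothing-passes ys

module Growth (s : ℕ) where

  extend : (List ℕ → ℕ) → List ℕ → ℕ → ℕ
  extend f d j = ind (nonincr (inc d j)) ℕ.* f (inc d j)

  grow : (List ℕ → ℕ) → List ℕ → ℕ
  grow f d = sumN s (extend f d)

  paths : ℕ → (List ℕ → ℕ) → List ℕ → ℕ
  paths zero    f = f
  paths (suc m) f = grow (paths m f)

  IsShape : List ℕ → Set
  IsShape d = (length d ≡ s) × (nonincr d ≡ true)

  shape-empty : IsShape (emptyShape s)
  shape-empty = length-empty s , nonincr-empty s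

  grow-cong : ∀ {f g} → (∀ d → f d ≡ g d) → ∀ d → grow f d ≡ grow g d
  grow-cong eq d = sumN-cong s (λ j → cong (ind (nonincr (inc d j)) ℕ.*_) (eq (inc d j)))

  grow-ext : ∀ {f g} d → IsShape d → (∀ e → IsShape e → f e ≡ g e) → grow f d ≡ grow g d
  grow-ext {f} {g} d (len , _) eq = sumN-cong s step
    where
    step : ∀ j → extend f d j ≡ extend g d j
    step j with nonincr (inc d j) in valid
    ... | false = refl
    ... | true  = cong (1 ℕ.*_) (eq (inc d j) (trans (length-inc d j) len , valid))

  grow-+ : ∀ f g d → grow (λ e → f e ℕ.+ g e) d ≡ grow f d ℕ.+ grow g d
  grow-+ f g d =
    trans (sumN-cong s (λ j → ℕP.*-distribˡ-+ (ind (nonincr (inc d j))) _ _)) (sumN-+ s _ _)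

  grow-* : ∀ k f d → grow (λ e → k ℕ.* f e) d ≡ k ℕ.* grow f d
  grow-* k f d = trans (sumN-cong s (λ j → swap (ind (nonincr (inc d j))) k _)) (sumN-* s k _)
    where
    swap : ∀ b k x → b ℕ.* (k ℕ.* x) ≡ k ℕ.* (b ℕ.* x)
    swap = ℕ-solve

  grow-0 : ∀ d → grow (λ _ → 0) d ≡ 0
  grow-0 d = trans (sumN-cong s (λ j → ℕP.*-zeroʳ (ind (nonincr (inc d j)))))
                   (trans (sumN-const s 0) (ℕP.*-zeroʳ s))

  paths-ext : ∀ m {f g} c → IsShape c → (∀ e → IsShape e → f e ≡ g e) → paths m f c ≡ paths m g c
  paths-ext zero    c sc eq = eq c sc
  paths-ext (suc m) c sc eq = grow-ext c sc (λ e se → paths-ext m e se eq)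

  paths-+ : ∀ m f g c → paths m (λ e → f e ℕ.+ g e) c ≡ paths m f c ℕ.+ paths m g c
  paths-+ zero    f g c = refl
  paths-+ (suc m) f g c = trans (grow-cong (paths-+ m f g) c) (grow-+ (paths m f) (paths m g) c)

  paths-* : ∀ m k f c → paths m (λ e → k ℕ.* f e) c ≡ k ℕ.* paths m f c
  paths-* zero    k f c = refl
  paths-* (suc m) k f c = trans (grow-cong (paths-* m k f) c) (grow-* k (paths m f) c)

  paths-0 : ∀ m c → paths m (λ _ → 0) c ≡ 0
  paths-0 zero    c = refl
  paths-0 (suc m) c = trans (grow-cong (paths-0 m) c) (grow-0 c)

  paths-sum : ∀ m n (F : ℕ → List ℕ → ℕ) c →
              paths m (λ e → sumN n (λ k → F k e)) c ≡ sumN n (λ k → paths m (F k) c)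
  paths-sum m zero    F c = paths-0 m c
  paths-sum m (suc n) F c =
    trans (paths-+ m (F 0) _ c) (cong (paths m (F 0) c ℕ.+_) (paths-sum m n (F ∘ suc) c))

  paths-last : ∀ m f c → paths (suc m) f c ≡ paths m (grow f) c
  paths-last zero    f c = refl
  paths-last (suc m) f c = grow-cong (paths-last m f) c

  count-paths : ∀ m c (Q : List ℕ → Bool) →
    length (filterᵇ (λ w → validFrom c w ∧ Q (shapeFrom c w)) (words s m)) ≡ paths m (ind ∘ Q) c
  count-paths zero c Q with Q c
  ... | true  = refl
  ... | false = refl
  count-paths (suc m) c Q =
    trans (length-filter-concatMap _ (λ j → map (j ∷_) (words s m)) (allFin s))
      (sumList-tabulate s (λ j → j) _ _ first-letter)
    where
    first-letter : ∀ (j : Fin s) →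
      length (filterᵇ (λ w → validFrom c w ∧ Q (shapeFrom c w)) (map (j ∷_) (words s m)))
      ≡ extend (paths m (ind ∘ Q)) c (toℕ j)
    first-letter j =
      trans (length-filter-map _ (j ∷_) (words s m))
        (trans (length-filter-guard (nonincr (inc c (toℕ j))) (validFrom (inc c (toℕ j)))
                  (Q ∘ shapeFrom (inc c (toℕ j))) (words s m))
               (cong (ind (nonincr (inc c (toℕ j))) ℕ.*_) (count-paths m (inc c (toℕ j)) Q)))

open Growth

γ-weight : ℤ → List ℕ → ℕ
γ-weight z d = ind ⌊ diff23 d ℤ.≟ z ⌋

r-weight : ℕ → ℤ → List ℕ → ℕ
r-weight j z d = ind (⌊ diff23 d ℤ.≟ z ⌋ ∧ (col d (j ∸ 1) ≡ᵇ col d j))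

γ-as-paths : ∀ s m z → γ s m z ≡ + paths s m (γ-weight z) (emptyShape s)
γ-as-paths s m z =
  cong +_ (trans (length-filter-filter _ _ (words s m))
                 (count-paths s m (emptyShape s) (λ d → ⌊ diff23 d ℤ.≟ z ⌋)))

r-as-paths : ∀ s j m z → r s j m z ≡ + paths s m (r-weight j z) (emptyShape s)
r-as-paths s j m z =
  cong +_ (trans (length-filter-filter _ _ (words s m))
                 (count-paths s m (emptyShape s) (λ d → ⌊ diff23 d ℤ.≟ z ⌋ ∧ (col d (j ∸ 1) ≡ᵇ col d j))))

≟-translate : ∀ z w c → ⌊ z + c ℤ.≟ w ⌋ ≡ ⌊ z ℤ.≟ w - c ⌋
≟-translate z w c with z + c ℤ.≟ w | z ℤ.≟ w - c
... | yes _ | yes _ = refl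
... | no  _ | no  _ = refl
... | yes p | no ¬q = contradiction (trans (cancel z c) (cong (_- c) p)) ¬q
  where
  cancel : ∀ z c → z ≡ z + c - c
  cancel = ℤ-solve
... | no ¬p | yes q = contradiction (trans (cong (_+ c) q) (cancel w c)) ¬p
  where
  cancel : ∀ w c → w - c + c ≡ w
  cancel = ℤ-solve

diff23-inc₁ : ∀ a b c u → diff23 (inc (a ∷ b ∷ c ∷ u) 1) ≡ diff23 (a ∷ b ∷ c ∷ u) + + 1
diff23-inc₁ a b c u = raise (+ b) (+ c)
  where
  raise : ∀ x y → + 1 + x - y ≡ x - y + + 1
  raise = ℤ-solve

diff23-inc₂ : ∀ a b c u → diff23 (inc (a ∷ b ∷ c ∷ u) 2) ≡ diff23 (a ∷ b ∷ c ∷ u) - + 1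
diff23-inc₂ a b c u = lower (+ b) (+ c)
  where
  lower : ∀ x y → x - (+ 1 + y) ≡ x - y - + 1
  lower = ℤ-solve

-- When columns 2 and 3 are tied, diff23 is 0, hence not positive.
tie-excludes : ∀ a b c u i → (b ≡ᵇ c) ≡ true → ⌊ diff23 (a ∷ b ∷ c ∷ u) ℤ.≟ + i + + 1 ⌋ ≡ false
tie-excludes a b c u i tie rewrite ≡ᵇ-true⇒≡ b c tie | ℤP.+-inverseʳ (+ c)
  with + 0 ℤ.≟ + i + + 1
... | no  _ = refl
... | yes e = contradiction (trans (sym (ℕP.+-comm i 1)) (sym (ℤP.+-injective e))) ℕP.1+n≢0

diff23-nonneg : ∀ d → nonincr d ≡ true → Σ ℕ (λ x → diff23 d ≡ + x)
diff23-nonneg []           _ = 0 , refl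
diff23-nonneg (a ∷ [])     _ = 0 , refl
diff23-nonneg (a ∷ b ∷ []) _ = b ℕ.+ 0 , refl
diff23-nonneg (a ∷ b ∷ c ∷ u) h = b ∸ c , trans (ℤP.m-n≡m⊖n b c) (ℤP.⊖-≥ c≤b)
  where
  c≤b : c ≤ b
  c≤b = ≤ᵇ-true⇒≤ c b (∧-conicalˡ (c ≤ᵇ b) (nonincr (c ∷ u)) (∧-conicalʳ (b ≤ᵇ a) _ h))

diff23-never-negative : ∀ d → nonincr d ≡ true → ⌊ diff23 d ℤ.≟ + 0 - + 1 ⌋ ≡ false
diff23-never-negative d h with diff23-nonneg d h
... | x , eq rewrite eq = refl

local-recurrence : ∀ t i d → IsShape (3 ℕ.+ t) d →
  grow (3 ℕ.+ t) (γ-weight (+ i)) d ℕ.+ (r-weight 1 (+ i - + 1) d ℕ.+ sumN t (λ k → r-weight (3 ℕ.+ k) (+ i) d))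
  ≡ γ-weight (+ i - + 1) d ℕ.+ (suc t ℕ.* γ-weight (+ i) d ℕ.+ γ-weight (+ i + + 1) d)
local-recurrence t i d@(a ∷ b ∷ c ∷ u) (len , h) = begin
    E 0 ℕ.+ (E 1 ℕ.+ (E 2 ℕ.+ ST)) ℕ.+ (R₁ ℕ.+ SR) ≡⟨ regroup (E 0) (E 1) (E 2) ST R₁ SR ⟩
    E 0 ℕ.+ (E 1 ℕ.+ R₁) ℕ.+ E 2 ℕ.+ (ST ℕ.+ SR)   ≡⟨ cong₂ ℕ._+_ (cong₂ ℕ._+_ (cong₂ ℕ._+_ column₁ column₂) column₃)
                                                               later-columns ⟩
    D ℕ.+ D₋ ℕ.+ D₊ ℕ.+ t ℕ.* D                     ≡⟨ collect D D₋ D₊ t ⟩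
    D₋ ℕ.+ (suc t ℕ.* D ℕ.+ D₊)                      ∎
  where
  open ≡-Reasoning
  -- E j is the term of grow for column j+1; ST and SR collect columns 4..s and their ties.
  D D₋ D₊ R₁ ST SR : ℕ
  D  = γ-weight (+ i) d
  D₋ = γ-weight (+ i - + 1) d
  D₊ = γ-weight (+ i + + 1) d
  R₁ = r-weight 1 (+ i - + 1) d
  E : ℕ → ℕ
  E = extend (3 ℕ.+ t) (γ-weight (+ i)) d
  ST = sumN t (E ∘ (3 ℕ.+_))
  SR = sumN t (λ k → r-weight (3 ℕ.+ k) (+ i) d)

  regroup : ∀ e₀ e₁ e₂ x r y → e₀ ℕ.+ (e₁ ℕ.+ (e₂ ℕ.+ x)) ℕ.+ (r ℕ.+ y) ≡ e₀ ℕ.+ (e₁ ℕ.+ r) ℕ.+ e₂ ℕ.+ (x ℕ.+ y)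
  regroup = ℕ-solve
  collect : ∀ x x₋ x₊ n → x ℕ.+ x₋ ℕ.+ x₊ ℕ.+ n ℕ.* x ≡ x₋ ℕ.+ ((1 ℕ.+ n) ℕ.* x ℕ.+ x₊)
  collect = ℕ-solve

  -- Column 1 always grows and keeps diff23.
  column₁ : E 0 ≡ D
  column₁ = ind-true D (nonincr-inc₀ a (b ∷ c ∷ u) h)

  -- Column 2 grows unless tied with column 1, raising diff23; the ties are r₁.
  column₂ : E 1 ℕ.+ R₁ ≡ D₋
  column₂ = trans (cong₂ (λ v x → ind v ℕ.* ind x ℕ.+ R₁)
                         (nonincr-inc d 0 h (s≤s (s≤s z≤n)))
                         (trans (cong (λ z → ⌊ z ℤ.≟ + i ⌋) (diff23-inc₁ a b c u))
                                (≟-translate (diff23 d) (+ i) (+ 1))))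
                  (split-on ⌊ diff23 d ℤ.≟ + i - + 1 ⌋ (a ≡ᵇ b))

  -- Column 3 grows unless tied with column 2, lowering diff23; a tie forces diff23 = 0.
  column₃ : E 2 ≡ D₊
  column₃ = trans (cong₂ (λ v x → ind v ℕ.* ind x)
                         (nonincr-inc d 1 h (s≤s (s≤s (s≤s z≤n))))
                         (trans (cong (λ z → ⌊ z ℤ.≟ + i ⌋) (diff23-inc₂ a b c u))
                                (≟-translate (diff23 d) (+ i) (ℤ.- + 1))))
                  (guard-redundant _ (b ≡ᵇ c) (tie-excludes a b c u i))

  -- Column 3+k+1 grows unless tied with column 3+k and keeps diff23; the ties are r_{3+k}.
  column-later : ∀ k → k < t → E (3 ℕ.+ k) ℕ.+ r-weight (3 ℕ.+ k) (+ i) d ≡ D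
  column-later k k<t =
    trans (cong (λ v → ind v ℕ.* D ℕ.+ r-weight (3 ℕ.+ k) (+ i) d)
                (nonincr-inc d (2 ℕ.+ k) h (s≤s (s≤s (s≤s (subst (k <_) (sym (cong (_∸ 3) len)) k<t))))))
          (split-on ⌊ diff23 d ℤ.≟ + i ⌋ (col d (2 ℕ.+ k) ≡ᵇ col d (3 ℕ.+ k)))

  later-columns : ST ℕ.+ SR ≡ t ℕ.* D
  later-columns = trans (sym (sumN-+ t _ _)) (trans (sumN-cong< t column-later) (sumN-const t D))

-- Applying the linear map paths m to local-recurrence gives the recurrence for
-- path sums from any starting Young diagram c.
path-recurrence : ∀ t m i c → IsShape (3 ℕ.+ t) c →
  let P = λ f → paths (3 ℕ.+ t) m f c in
  paths (3 ℕ.+ t) (suc m) (γ-weight (+ i)) c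
    ℕ.+ (P (r-weight 1 (+ i - + 1)) ℕ.+ sumN t (λ k → P (r-weight (3 ℕ.+ k) (+ i))))
  ≡ P (γ-weight (+ i - + 1)) ℕ.+ (suc t ℕ.* P (γ-weight (+ i)) ℕ.+ P (γ-weight (+ i + + 1)))
path-recurrence t m i c sc = begin
    paths s (suc m) D c ℕ.+ (P R₁ ℕ.+ sumN t (λ k → P (R k)))
  ≡⟨ cong₂ ℕ._+_ (paths-last s m D c) (cong (P R₁ ℕ.+_) (sym (paths-sum s m t R c))) ⟩
    P (grow s D) ℕ.+ (P R₁ ℕ.+ P (λ e → sumN t (λ k → R k e)))
  ≡⟨ cong (P (grow s D) ℕ.+_) (sym (paths-+ s m R₁ _ c)) ⟩
    P (grow s D) ℕ.+ P (λ e → R₁ e ℕ.+ sumN t (λ k → R k e))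
  ≡⟨ sym (paths-+ s m _ _ c) ⟩
    P (λ e → grow s D e ℕ.+ (R₁ e ℕ.+ sumN t (λ k → R k e)))
  ≡⟨ paths-ext s m c sc (local-recurrence t i) ⟩
    P (λ e → D₋ e ℕ.+ (suc t ℕ.* D e ℕ.+ D₊ e))
  ≡⟨ trans (paths-+ s m D₋ _ c) (cong (P D₋ ℕ.+_) (trans (paths-+ s m _ D₊ c)
                                                       (cong (ℕ._+ P D₊) (paths-* s m (suc t) D c)))) ⟩
    P D₋ ℕ.+ (suc t ℕ.* P D ℕ.+ P D₊)
  ∎
  where
  open ≡-Reasoning
  s : ℕ
  s = 3 ℕ.+ t
  P : (List ℕ → ℕ) → ℕ
  P f = paths s m f c
  D D₋ D₊ R₁ : List ℕ → ℕ
  D  = γ-weight (+ i)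
  D₋ = γ-weight (+ i - + 1)
  D₊ = γ-weight (+ i + + 1)
  R₁ = r-weight 1 (+ i - + 1)
  R : ℕ → List ℕ → ℕ
  R k = r-weight (3 ℕ.+ k) (+ i)

move-to-ℤ : ∀ {x₀ x₁ x₂ x₃ y₁ y₂ : ℤ} {a b c d e f : ℕ} k →
  x₀ ≡ + a → x₁ ≡ + d → x₂ ≡ + e → x₃ ≡ + f → y₁ ≡ + b → y₂ ≡ + c →
  a ℕ.+ (b ℕ.+ c) ≡ d ℕ.+ (k ℕ.* e ℕ.+ f) →
  x₀ ≡ x₁ + + k * x₂ + x₃ - y₁ - y₂
move-to-ℤ {a = a} {b} {c} {d} {e} {f} k refl refl refl refl refl refl eq = begin
    + a                                 ≡⟨ cancel (+ a) (+ b) (+ c) ⟩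
    + a + (+ b + + c) - + b - + c       ≡⟨ cong (λ z → z - + b - + c) (cong +_ eq) ⟩
    + d + (+ (k ℕ.* e) + + f) - + b - + c ≡⟨ cong (λ z → + d + (z + + f) - + b - + c) (ℤP.pos-* k e) ⟩
    + d + (+ k * + e + + f) - + b - + c ≡⟨ reassociate (+ d) (+ k * + e) (+ f) (+ b) (+ c) ⟩
    + d + + k * + e + + f - + b - + c   ∎
  where
  open ≡-Reasoning
  cancel : ∀ x y z → x ≡ x + (y + z) - y - z
  cancel = ℤ-solve
  reassociate : ∀ x y z u v → x + (y + z) - u - v ≡ x + y + z - u - v
  reassociate = ℤ-solve

fold-as-sumN : ∀ n (h : ℕ → ℕ) (G : ℕ → ℤ) (f : ℕ → ℕ) → (∀ k → G (h k) ≡ + f k) →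
  foldr ℤ._+_ (+ 0) (map G (applyUpTo h n)) ≡ + sumN n f
fold-as-sumN zero    h G f eq = refl
fold-as-sumN (suc n) h G f eq =
  cong₂ ℤ._+_ (eq 0) (fold-as-sumN n (h ∘ suc) G (f ∘ suc) (eq ∘ suc))

recurrence : ∀ t m i →
  γ (3 ℕ.+ t) (suc m) (+ i) ≡ γ (3 ℕ.+ t) m (+ i - + 1) + (+ suc t) * γ (3 ℕ.+ t) m (+ i)
      + γ (3 ℕ.+ t) m (+ i + + 1) - r (3 ℕ.+ t) 1 m (+ i - + 1)
      - sum3to (3 ℕ.+ t) (λ j → r (3 ℕ.+ t) j m (+ i))
recurrence t m i = move-to-ℤ (suc t)
  (γ-as-paths s (suc m) _) (γ-as-paths s m _) (γ-as-paths s m _) (γ-as-paths s m _) (r-as-paths s 1 m _)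
  (fold-as-sumN t (λ k → k) (λ k → r s (3 ℕ.+ k) m (+ i)) _ (λ k → r-as-paths s (3 ℕ.+ k) m (+ i)))
  (path-recurrence t m i (emptyShape s) (shape-empty s))
  where
  s : ℕ
  s = 3 ℕ.+ t

-- At i = 0 the terms with diff23 = -1 vanish, since diff23 ≥ 0 on Young diagrams.
γ-at-minus-one : ∀ s m → γ s m (+ 0 - + 1) ≡ + 0
γ-at-minus-one s m =
  trans (γ-as-paths s m _)
        (cong +_ (trans (paths-ext s m _ (shape-empty s) (λ d (_ , h) → cong ind (diff23-never-negative d h)))
                        (paths-0 s m _)))

r₁-at-minus-one : ∀ s m → r s 1 m (+ 0 - + 1) ≡ + 0
r₁-at-minus-one s m =
  trans (r-as-paths s 1 m _)
        (cong +_ (trans (paths-ext s m _ (shape-empty s)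
                                   (λ d (_ , h) → cong (λ v → ind (v ∧ (col d 0 ≡ᵇ col d 1))) (diff23-never-negative d h)))
                        (paths-0 s m _)))

proposition9 : (s : ℕ) → 4 ≤ s → (n : ℕ) → s ≤ n →
    (γ s n (+ 0) ≡ (+ (s ∸ 2)) * γ s (n ∸ 1) (+ 0) + γ s (n ∸ 1) (+ 1)
                    - sum3to s (λ j → r s j (n ∸ 1) (+ 0)))
    × ((i : ℕ) → 1 ≤ i → i ≤ n / 2 →
        γ s n (+ i) ≡ γ s (n ∸ 1) (+ i - + 1) + (+ (s ∸ 2)) * γ s (n ∸ 1) (+ i)
                      + γ s (n ∸ 1) (+ i + + 1)
                      - r s 1 (n ∸ 1) (+ i - + 1)
                      - sum3to s (λ j → r s j (n ∸ 1) (+ i)))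
proposition9 (suc (suc (suc (suc s')))) (s≤s (s≤s (s≤s (s≤s _)))) zero ()
proposition9 s@(suc (suc (suc (suc s')))) (s≤s (s≤s (s≤s (s≤s _)))) (suc m) _ =
  i-zero , λ i _ _ → recurrence (suc s') m i
  where
  drop-zeros : ∀ x y z → + 0 + x + y - + 0 - z ≡ x + y - z
  drop-zeros = ℤ-solve
  i-zero : γ s (suc m) (+ 0) ≡ (+ (s ∸ 2)) * γ s m (+ 0) + γ s m (+ 1) - sum3to s (λ j → r s j m (+ 0))
  i-zero = begin
      γ s (suc m) (+ 0)
    ≡⟨ recurrence (suc s') m 0 ⟩
      γ s m (+ 0 - + 1) + (+ (s ∸ 2)) * γ s m (+ 0) + γ s m (+ 1) - r s 1 m (+ 0 - + 1) - Σr
    ≡⟨ cong₂ (λ g ρ → g + (+ (s ∸ 2)) * γ s m (+ 0) + γ s m (+ 1) - ρ - Σr)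
             (γ-at-minus-one s m) (r₁-at-minus-one s m) ⟩
      + 0 + (+ (s ∸ 2)) * γ s m (+ 0) + γ s m (+ 1) - + 0 - Σr
    ≡⟨ drop-zeros ((+ (s ∸ 2)) * γ s m (+ 0)) (γ s m (+ 1)) Σr ⟩
      (+ (s ∸ 2)) * γ s m (+ 0) + γ s m (+ 1) - Σr
    ∎
    where
    open ≡-Reasoning
    Σr : ℤ
    Σr = sum3to s (λ j → r s j m (+ 0))
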